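{- If $n=2x^2+3y^2>0$ with $x,y\in\mathbb{Z}$ and $5\mid n$, then there exist $u,v\in\mathbb{Z}$ with $5\nmid uv$ such that $n=2u^2+3v^2$. -}

module Defs where

-- Write Q(x, y) = 2x² + 3y².  If 5 divides both x and y, then Q(x, y) = 25 Q(x/5, y/5), so
-- dividing out common factors 5 gives n = Q(a, b) with 5 not dividing both a and b.  The
-- composition Q(a, b)(c² + 6d²) = Q(ac + 3bd, bc − 2ad) with (c, d) = (1, ±2) multiplies
-- the value by 25 while producing coordinates congruent to a ± b modulo 5; one of the two
-- signs avoids 0, so the factors 25 can be restored one at a time keeping both coordinates
-- prime to 5.  Finally, 5 ∣ Q(a, b) forces 5 ∣ a ⇔ 5 ∣ b, so in the reduced representation
-- neither coordinate is divisible by 5.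
module Submission where

open import Defs
open import Data.Integer using (ℤ; +_; _+_; _*_; _<_)
open import Data.Integer.Divisibility using (_∣_)
open import Data.Product using (∃₂; _×_)
open import Relation.Nullary using (¬_)
open import Relation.Binary.PropositionalEquality using (_≡_)

open import Data.Integer using (0ℤ; _-_; -_; ∣_∣)
open import Data.Integer.Properties using (abs-*; ∣i∣≡0⇒i≡0; <-irrefl)
open import Data.Integer.Divisibility.Signed
  using (divides; ∣ᵤ⇒∣; ∣⇒∣ᵤ; ∣-refl; _∣?_; ∣m∣n⇒∣m+n; ∣m∣n⇒∣m-n; ∣m+n∣m⇒∣n; ∣m+n∣n⇒∣m; ∣m⇒∣m*n; ∣n⇒∣m*n)
  renaming (_∣_ to _∣ₛ_)
open import Data.Integer.Tactic.RingSolver using (solve-∀)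
open import Data.Nat as ℕ using (ℕ; ≢-nonZero)
open import Data.Nat.Properties using (m+n≡0⇒m≡0; m+n≡0⇒n≡0; m<m*n; *-distribʳ-+; module ≤-Reasoning)
open import Data.Nat.Divisibility using () renaming (_∣_ to _∣ℕ_)
open import Data.Nat.Primality using (Prime; prime?; euclidsLemma)
open import Data.Nat.Induction using (<-wellFounded)
open import Induction.WellFounded using (Acc; acc)
open import Data.Product using (_,_)
open import Data.Sum using (_⊎_; inj₁; inj₂)
open import Relation.Nullary using (yes; no; contradiction)
open import Relation.Nullary.Decidable using (from-yes; from-no; _×-dec_)
open import Relation.Binary.PropositionalEquality using (refl; sym; trans; cong; cong₂; subst; module ≡-Reasoning)

private
  variable
    c k m n : ℤ

∣ₛ-euclid : ∀ {p} → Prime p → + p ∣ₛ m * n → + p ∣ₛ m ⊎ + p ∣ₛ n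
∣ₛ-euclid {m} {n} {p} p-prime p∣mn
  with euclidsLemma ∣ m ∣ ∣ n ∣ p-prime (subst (p ∣ℕ_) (abs-* m n) (∣⇒∣ᵤ p∣mn))
... | inj₁ p∣m = inj₁ (∣ᵤ⇒∣ p∣m)
... | inj₂ p∣n = inj₂ (∣ᵤ⇒∣ p∣n)

∣ₛ-square⇒∣ₛ : ∀ {p} → Prime p → + p ∣ₛ m * m → + p ∣ₛ m
∣ₛ-square⇒∣ₛ p-prime p∣mm with ∣ₛ-euclid p-prime p∣mm
... | inj₁ p∣m = p∣m
... | inj₂ p∣m = p∣m

∣ₛ-cancel-coprime : ∀ {p} → Prime p → ¬ + p ∣ₛ c → + p ∣ₛ c * m → + p ∣ₛ m
∣ₛ-cancel-coprime p-prime p∤c p∣cm with ∣ₛ-euclid p-prime p∣cm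
... | inj₁ p∣c = contradiction p∣c p∤c
... | inj₂ p∣m = p∣m

∤ₛ⇒∤ₛ+multiple : ∀ n → ¬ k ∣ₛ m → ¬ k ∣ₛ m + n * k
∤ₛ⇒∤ₛ+multiple {k} n k∤m k∣m+nk = k∤m (∣m+n∣n⇒∣m k∣m+nk (∣n⇒∣m*n n (∣-refl {k})))

prime-5 : Prime 5
prime-5 = from-yes (prime? 5)

5∤2 : ¬ + 5 ∣ₛ + 2
5∤2 = from-no (+ 5 ∣? + 2)

5∤3 : ¬ + 5 ∣ₛ + 3
5∤3 = from-no (+ 5 ∣? + 3)

Q : ℤ → ℤ → ℤ
Q x y = + 2 * (x * x) + + 3 * (y * y)

-- The ring solver does not unfold Q, so its identities are stated with Q written out.
Q-*5 : ∀ x y → + 2 * ((x * + 5) * (x * + 5)) + + 3 * ((y * + 5) * (y * + 5))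
             ≡ + 25 * (+ 2 * (x * x) + + 3 * (y * y))
Q-*5 = solve-∀

Q-neg : ∀ x y → + 2 * (x * x) + + 3 * (- y * - y) ≡ + 2 * (x * x) + + 3 * (y * y)
Q-neg = solve-∀

-- Q(x, y)(c² + 6d²) = Q(xc + 3yd, yc − 2xd) at (c, d) = (1, 2), where c² + 6d² = 25.
Q-compose-25 : ∀ x y → + 2 * ((x + + 6 * y) * (x + + 6 * y)) + + 3 * ((y - + 4 * x) * (y - + 4 * x))
                     ≡ + 25 * (+ 2 * (x * x) + + 3 * (y * y))
Q-compose-25 = solve-∀

5∣Q∧5∣x⇒5∣y : ∀ {x y} → + 5 ∣ₛ Q x y → + 5 ∣ₛ x → + 5 ∣ₛ y
5∣Q∧5∣x⇒5∣y {x} 5∣Q 5∣x =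
  ∣ₛ-square⇒∣ₛ prime-5 (∣ₛ-cancel-coprime prime-5 5∤3
    (∣m+n∣m⇒∣n 5∣Q (∣n⇒∣m*n (+ 2) (∣m⇒∣m*n x 5∣x))))

5∣Q∧5∣y⇒5∣x : ∀ {x y} → + 5 ∣ₛ Q x y → + 5 ∣ₛ y → + 5 ∣ₛ x
5∣Q∧5∣y⇒5∣x {y = y} 5∣Q 5∣y =
  ∣ₛ-square⇒∣ₛ prime-5 (∣ₛ-cancel-coprime prime-5 5∤2
    (∣m+n∣n⇒∣m 5∣Q (∣n⇒∣m*n (+ 3) (∣m⇒∣m*n y 5∣y))))

5∣Q⇒5∤x*y : ∀ {x y} → + 5 ∣ₛ Q x y → ¬ (+ 5 ∣ₛ x × + 5 ∣ₛ y) → ¬ + 5 ∣ₛ x * y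
5∣Q⇒5∤x*y 5∣Q ¬both 5∣xy with ∣ₛ-euclid prime-5 5∣xy
... | inj₁ 5∣x = ¬both (5∣x , 5∣Q∧5∣x⇒5∣y 5∣Q 5∣x)
... | inj₂ 5∣y = ¬both (5∣Q∧5∣y⇒5∣x 5∣Q 5∣y , 5∣y)

5∣x+y∧5∣x-y⇒5∣x∧5∣y : ∀ {x y} → + 5 ∣ₛ x + y → + 5 ∣ₛ x - y → + 5 ∣ₛ x × + 5 ∣ₛ y
5∣x+y∧5∣x-y⇒5∣x∧5∣y {x} {y} 5∣x+y 5∣x-y =
    ∣ₛ-cancel-coprime prime-5 5∤2 (subst (+ 5 ∣ₛ_) (sum x y) (∣m∣n⇒∣m+n 5∣x+y 5∣x-y))
  , ∣ₛ-cancel-coprime prime-5 5∤2 (subst (+ 5 ∣ₛ_) (difference x y) (∣m∣n⇒∣m-n 5∣x+y 5∣x-y))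
  where
  sum : ∀ x y → (x + y) + (x - y) ≡ + 2 * x
  sum = solve-∀
  difference : ∀ x y → (x + y) - (x - y) ≡ + 2 * y
  difference = solve-∀

Q-compose-25-∤ : ∀ x y → ¬ + 5 ∣ₛ x + y → ¬ + 5 ∣ₛ x + + 6 * y × ¬ + 5 ∣ₛ y - + 4 * x
Q-compose-25-∤ x y 5∤x+y =
    subst (λ z → ¬ + 5 ∣ₛ z) (sym (first x y)) (∤ₛ⇒∤ₛ+multiple y 5∤x+y)
  , subst (λ z → ¬ + 5 ∣ₛ z) (sym (second x y)) (∤ₛ⇒∤ₛ+multiple (- x) 5∤x+y)
  where
  first : ∀ x y → x + + 6 * y ≡ (x + y) + y * + 5
  first = solve-∀
  second : ∀ x y → y - + 4 * x ≡ (x + y) + (- x) * + 5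
  second = solve-∀

Scaled-by-25 : ℤ → ℤ → Set
Scaled-by-25 x y = ∃₂ λ u v → ¬ + 5 ∣ₛ u × ¬ + 5 ∣ₛ v × Q u v ≡ + 25 * Q x y

scale-by-25 : ∀ {x y} → ¬ (+ 5 ∣ₛ x × + 5 ∣ₛ y) → Scaled-by-25 x y
scale-by-25 {x} {y} ¬both with + 5 ∣? x + y
... | no 5∤x+y =
  let 5∤u , 5∤v = Q-compose-25-∤ x y 5∤x+y
  in x + + 6 * y , y - + 4 * x , 5∤u , 5∤v , Q-compose-25 x y
... | yes 5∣x+y =
  let 5∤u , 5∤v = Q-compose-25-∤ x (- y) (λ 5∣x-y → ¬both (5∣x+y∧5∣x-y⇒5∣x∧5∣y 5∣x+y 5∣x-y))
  in x + + 6 * - y , - y - + 4 * x , 5∤u , 5∤v , trans (Q-compose-25 x (- y)) (cong (+ 25 *_) (Q-neg x y))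

measure : ℤ → ℤ → ℕ
measure x y = ∣ x ∣ ℕ.+ ∣ y ∣

measure≡0⇒both≡0 : ∀ x y → measure x y ≡ 0 → x ≡ 0ℤ × y ≡ 0ℤ
measure≡0⇒both≡0 x y eq = ∣i∣≡0⇒i≡0 (m+n≡0⇒m≡0 ∣ x ∣ eq) , ∣i∣≡0⇒i≡0 (m+n≡0⇒n≡0 ∣ x ∣ eq)

measure-*-< : ∀ {x y} k → 1 ℕ.< k → ¬ (x ≡ 0ℤ × y ≡ 0ℤ) → measure x y ℕ.< measure (x * + k) (y * + k)
measure-*-< {x} {y} k 1<k nonzero = begin-strict
  measure x y                  <⟨ m<m*n (measure x y) k {{≢-nonZero (λ eq → nonzero (measure≡0⇒both≡0 x y eq))}} 1<k ⟩
  measure x y ℕ.* k            ≡⟨ *-distribʳ-+ k ∣ x ∣ ∣ y ∣ ⟩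
  ∣ x ∣ ℕ.* k ℕ.+ ∣ y ∣ ℕ.* k  ≡⟨ sym (cong₂ ℕ._+_ (abs-* x (+ k)) (abs-* y (+ k))) ⟩
  measure (x * + k) (y * + k)  ∎
  where open ≤-Reasoning

Reduced : ℤ → ℤ → Set
Reduced x y = ∃₂ λ u v → ¬ (+ 5 ∣ₛ u × + 5 ∣ₛ v) × Q x y ≡ Q u v

reduce : ∀ x y → ¬ (x ≡ 0ℤ × y ≡ 0ℤ) → Acc ℕ._<_ (measure x y) → Reduced x y
reduce x y nonzero (acc rec) with (+ 5 ∣? x) ×-dec (+ 5 ∣? y)
... | no ¬both = x , y , ¬both , refl
... | yes (divides a refl , divides b refl)
  with reduce a b nonzero-ab (rec (measure-*-< 5 (ℕ.s<s ℕ.z<s) nonzero-ab))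
  where
  nonzero-ab : ¬ (a ≡ 0ℤ × b ≡ 0ℤ)
  nonzero-ab (a≡0 , b≡0) = nonzero (cong (_* + 5) a≡0 , cong (_* + 5) b≡0)
... | u , v , ¬both , Qab≡Quv =
  let u′ , v′ , 5∤u′ , _ , Qu′v′≡25Quv = scale-by-25 ¬both
  in u′ , v′ , (λ (5∣u′ , _) → 5∤u′ 5∣u′) , (begin
    Q (a * + 5) (b * + 5)  ≡⟨ Q-*5 a b ⟩
    + 25 * Q a b           ≡⟨ cong (+ 25 *_) Qab≡Quv ⟩
    + 25 * Q u v           ≡⟨ Qu′v′≡25Quv ⟨
    Q u′ v′                ∎)
  where open ≡-Reasoning

Q-pos⇒nonzero : ∀ {x y} → + 0 < Q x y → ¬ (x ≡ 0ℤ × y ≡ 0ℤ)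
Q-pos⇒nonzero 0<Q (refl , refl) = <-irrefl refl 0<Q

lemma3p2 : (n x y : ℤ) → n ≡ + 2 * (x * x) + + 3 * (y * y) → + 0 < n → + 5 ∣ n →
    ∃₂ λ (u v : ℤ) → (¬ (+ 5 ∣ u * v)) × (n ≡ + 2 * (u * u) + + 3 * (v * v))
lemma3p2 n x y refl 0<n 5∣n
  with reduce x y (Q-pos⇒nonzero 0<n) (<-wellFounded (measure x y))
... | u , v , ¬both , Qxy≡Quv = u , v , 5∤uv , Qxy≡Quv
  where
  5∣Quv : + 5 ∣ₛ Q u v
  5∣Quv = subst (+ 5 ∣ₛ_) Qxy≡Quv (∣ᵤ⇒∣ 5∣n)
  5∤uv : ¬ + 5 ∣ u * v
  5∤uv 5∣uv = 5∣Q⇒5∤x*y 5∣Quv ¬both (∣ᵤ⇒∣ 5∣uv)
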